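{- Let $r\ge 0$ and $n$ be integers with $n\ge 3r+1$, and let $F$ be a set of $r$ pairwise independent (vertex-disjoint) edges of the complete graph $K_n$. Then $\mathrm{m}(K_n\setminus F)=r+2$, where $K_n\setminus F$ is the graph obtained from $K_n$ by deleting the edges of $F$.
   Context: All graphs are finite, simple and undirected. Given a graph $G$ and a list $L(v)$ of colors assigned to each vertex $v$, an $L$-coloring is a proper vertex coloring $c$ of $G$ with $c(v)\in L(v)$ for every vertex $v$. A graph $G$ is uniquely $k$-list colorable if there exist lists $L(v)$, each consisting of exactly $k$ colors, such that $G$ has exactly one $L$-coloring. $G$ has the property $M(k)$ if it is not uniquely $k$-list colorable. The m-number $\mathrm{m}(G)$ is the least integer $k$ such that $G$ has the property $M(k)$. -}

module Defs where

open import Data.Nat using (ℕ; _<_; _≤_; suc)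
open import Data.Fin using (Fin)
open import Data.List using (List; length)
open import Data.List.Relation.Unary.Unique.Propositional using (Unique)
open import Data.List.Membership.Propositional using (_∈_)
open import Data.Product using (Σ; ∃; _×_)
open import Data.Sum using (_⊎_)
open import Relation.Binary.PropositionalEquality using (_≡_; _≢_)
open import Relation.Nullary using (¬_)

Graph : ℕ → Set₁
Graph n = Fin n → Fin n → Set

ListAssignment : ℕ → Set
ListAssignment n = Fin n → List ℕ

IsKAssignment : {n : ℕ} → ℕ → ListAssignment n → Set
IsKAssignment {n} k L = (v : Fin n) → Unique (L v) × length (L v) ≡ k

IsLColoring : {n : ℕ} → Graph n → ListAssignment n → (Fin n → ℕ) → Set
IsLColoring {n} G L c =
  ((u v : Fin n) → G u v → c u ≢ c v) × ((v : Fin n) → c v ∈ L v)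

UniqueLColoring : {n : ℕ} → Graph n → ListAssignment n → Set
UniqueLColoring {n} G L =
  Σ (Fin n → ℕ) λ c → IsLColoring G L c ×
    ((c' : Fin n → ℕ) → IsLColoring G L c' → (v : Fin n) → c' v ≡ c v)

UniquelyKListColorable : {n : ℕ} → Graph n → ℕ → Set
UniquelyKListColorable {n} G k =
  Σ (ListAssignment n) λ L → IsKAssignment k L × UniqueLColoring G L

HasM : {n : ℕ} → Graph n → ℕ → Set
HasM G k = ¬ UniquelyKListColorable G k

IsMNumber : {n : ℕ} → Graph n → ℕ → Set
IsMNumber G m = 1 ≤ m × HasM G m × ((k : ℕ) → 1 ≤ k → k < m → ¬ HasM G k)

-- r pairwise vertex-disjoint edges {a i, b i} (i : Fin r) of K_n:
-- all 2r endpoints are distinct.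
IsMatching : {n r : ℕ} → (Fin r → Fin n) → (Fin r → Fin n) → Set
IsMatching {n} {r} a b =
  ((i j : Fin r) → a i ≡ a j → i ≡ j) ×
  ((i j : Fin r) → b i ≡ b j → i ≡ j) ×
  ((i j : Fin r) → a i ≢ b j)

KnMinus : {n r : ℕ} → (Fin r → Fin n) → (Fin r → Fin n) → Graph n
KnMinus {n} {r} a b u v =
  u ≢ v × ¬ (∃ λ (i : Fin r) → (u ≡ a i × v ≡ b i) ⊎ (u ≡ b i × v ≡ a i))

{-# OPTIONS --safe #-}
module Submission where

-- m ≤ r + 2: suppose c is the only L-coloring for lists of size r + 2. Each list L v contains
-- a color x v different from c v and from every c (a i). Since c is the only L-coloring, c
-- uses x v, and since x v avoids every c (a i), only at a single vertex f v. Giving every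
-- vertex u on a cycle of f the color c (f u) yields a second L-coloring.
--
-- m > r + 1: for lists of size m + 1 ≤ r + 1, the colors are the names of the vertices
-- outside B = {b i}. The lists of a i and b i are a i plus two disjoint m-sets of other such
-- vertices (this needs n ≥ 3r + 1), and any other vertex v gets v, a 0, …, a (m − 1).
-- With only n − r colors, every coloring gives a i and b i a common color, necessarily a i,
-- and then every other vertex v is forced to take color v.

open import Defs
open import Data.Nat using (ℕ; zero; suc; _+_; _*_; _≤_; _<_; z≤n; s≤s; s≤s⁻¹)
open import Data.Nat.Properties
  using (module ≤-Reasoning; ≤-trans; ≤-reflexive; <-irrefl; 1+n≰n; +-comm; +-assoc; +-identityʳ; *-comm;
         +-mono-≤; +-cancelʳ-≤; m≤n+m; m+n≤o⇒m≤o; m+n≤o⇒m≤o∸n; m≤n⇒m⊓n≡m; m≤n⇒∃[o]m+o≡n)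
  renaming (_≟_ to _≟ℕ_)
open import Data.Fin using (Fin; toℕ; fromℕ<; punchOut; _≟_)
open import Data.Fin.Properties
  using (any?; punchOut-injective; injective⇒≤; pigeonhole; toℕ-fromℕ<; toℕ<n; toℕ-injective)
open import Data.List using (List; []; _∷_; _++_; length; map; take; drop; filter; allFin; tabulate)
open import Data.List.Properties
  using (length-removeAt′; length-take; length-drop; length-map; length-++; length-tabulate)
open import Data.List.Relation.Unary.All as All using (All; _∷_; all?)
open import Data.List.Relation.Unary.All.Properties using (¬All⇒Any¬; all-filter; take⁺; drop⁺)
open import Data.List.Relation.Unary.Any using (here; there; _─_)
open import Data.List.Relation.Unary.AllPairs using (_∷_)
open import Data.List.Relation.Unary.Unique.Propositional using (Unique)
import Data.List.Relation.Unary.Unique.Propositional.Properties as Unique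
open import Data.List.Relation.Binary.Subset.Propositional using (_⊆_)
open import Data.List.Membership.Propositional using (_∈_; _∉_; find)
import Data.List.Membership.DecPropositional as DecMembership
open import Data.List.Membership.Propositional.Properties
  using (∈-map⁺; ∈-map⁻; ∈-allFin; ∈-filter⁺; ∈-tabulate⁺; ∈-++⁺ˡ; ∈-++⁺ʳ)
open import Data.Product using (Σ; ∃; _×_; _,_; proj₁; proj₂)
open import Data.Sum using (_⊎_; inj₁; inj₂)
open import Data.Empty using (⊥)
open import Function using (_∘_; id)
open import Function.Definitions using (Injective)
open import Relation.Binary.Definitions using (DecidableEquality)
open import Relation.Binary.PropositionalEquality
open import Relation.Nullary using (¬_; yes; no; Dec; contradiction)
open import Relation.Nullary.Decidable using (_×-dec_; _⊎-dec_; ¬?; decidable-stable)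

module _ {A : Set} where

  ∈-─⁺ : {x y : A} {ys : List A} (p : x ∈ ys) → y ∈ ys → y ≢ x → y ∈ (ys ─ p)
  ∈-─⁺ (here refl) (here refl) y≢x = contradiction refl y≢x
  ∈-─⁺ (here refl) (there q)   _   = q
  ∈-─⁺ (there p)   (here refl) _   = here refl
  ∈-─⁺ (there p)   (there q)   y≢x = there (∈-─⁺ p q y≢x)

  Unique∧⊆⇒length≤ : {xs ys : List A} → Unique xs → xs ⊆ ys → length xs ≤ length ys
  Unique∧⊆⇒length≤ {[]}              _          _     = z≤n
  Unique∧⊆⇒length≤ {x ∷ xs} {ys} (x∉xs ∷ u) xs⊆ys = ≤-trans
    (s≤s (Unique∧⊆⇒length≤ u xs⊆ys─x∈ys)) (≤-reflexive (sym (length-removeAt′ ys _)))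
    where
    x∈ys : x ∈ ys
    x∈ys = xs⊆ys (here refl)
    xs⊆ys─x∈ys : xs ⊆ (ys ─ x∈ys)
    xs⊆ys─x∈ys y∈xs = ∈-─⁺ x∈ys (xs⊆ys (there y∈xs)) λ { refl → All.lookup x∉xs y∈xs refl }

  module _ (_≟A_ : DecidableEquality A) where
    open DecMembership _≟A_ using (_∈?_)

    length<⇒∃∉ : {xs ys : List A} → Unique xs → length ys < length xs → ∃ λ x → x ∈ xs × x ∉ ys
    length<⇒∃∉ {xs} {ys} u ys<xs with all? (_∈? ys) xs
    ... | yes xs⊆ys = contradiction (≤-trans ys<xs (Unique∧⊆⇒length≤ u (All.lookup xs⊆ys))) (<-irrefl refl)
    ... | no xs⊈ys  = find (¬All⇒Any¬ (_∈? ys) xs xs⊈ys)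

  Unique⇒take-drop-disjoint : ∀ m k {xs : List A} {x : A} → Unique xs →
    x ∈ take m xs → x ∈ take k (drop m xs) → ⊥
  Unique⇒take-drop-disjoint (suc m) k {y ∷ xs} (y∉xs ∷ _) (here refl) x∈rest =
    All.lookup (take⁺ k (drop⁺ m y∉xs)) x∈rest refl
  Unique⇒take-drop-disjoint (suc m) k {y ∷ xs} (_ ∷ u) (there x∈front) x∈rest =
    Unique⇒take-drop-disjoint m k u x∈front x∈rest

  length-take-≤ : ∀ m (xs : List A) → m ≤ length xs → length (take m xs) ≡ m
  length-take-≤ m xs m≤ = trans (length-take m xs) (m≤n⇒m⊓n≡m m≤)

injective⇒surjective : ∀ {n} {f : Fin n → Fin n} → Injective _≡_ _≡_ f → ∀ y → ∃ λ x → f x ≡ y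
injective⇒surjective {suc n} {f} f-inj y with any? (λ x → f x ≟ y)
... | yes hit = hit
... | no miss = contradiction (injective⇒≤ punched-injective) 1+n≰n
  where
  f≢y : ∀ x → y ≢ f x
  f≢y x y≡fx = miss (x , sym y≡fx)
  punched-injective : Injective _≡_ _≡_ (λ x → punchOut (f≢y x))
  punched-injective {x} {x′} = f-inj ∘ punchOut-injective (f≢y x) (f≢y x′)

module PeriodicPoints {n : ℕ} (f : Fin n → Fin n) where
  open import Function.Endo.Propositional (Fin n) using (_^_; ^-homo)

  IsPeriodic : Fin n → Set
  IsPeriodic u = ∃ λ (k : Fin n) → (f ^ suc (toℕ k)) u ≡ u

  isPeriodic? : ∀ u → Dec (IsPeriodic u)
  isPeriodic? u = any? λ k → (f ^ suc (toℕ k)) u ≟ u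

  ^-shift : ∀ k u → (f ^ k) (f u) ≡ (f ^ suc k) u
  ^-shift zero    u = refl
  ^-shift (suc k) u = cong f (^-shift k u)

  ^-return-multiple : ∀ m p {u} → (f ^ p) u ≡ u → (f ^ (m * p)) u ≡ u
  ^-return-multiple zero    p     ret = refl
  ^-return-multiple (suc m) p {u} ret = begin
    (f ^ (p + m * p)) u       ≡⟨ cong-app (^-homo f p (m * p)) u ⟩
    (f ^ p) ((f ^ (m * p)) u) ≡⟨ cong (f ^ p) (^-return-multiple m p ret) ⟩
    (f ^ p) u                 ≡⟨ ret ⟩
    u                         ∎
    where open ≡-Reasoning

  periodic-step : ∀ {u} → IsPeriodic u → IsPeriodic (f u)
  periodic-step {u} (k , ret) = k , trans (^-shift (suc (toℕ k)) u) (cong f ret)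

  -- Two periodic points both return after the product of their periods.
  periodic-injective : ∀ {u v} → IsPeriodic u → IsPeriodic v → f u ≡ f v → u ≡ v
  periodic-injective {u} {v} (k , u-ret) (l , v-ret) fu≡fv = begin
    u                ≡⟨ sym u-ret′ ⟩
    (f ^ suc N) u    ≡⟨ ^-shift N u ⟨
    (f ^ N) (f u)    ≡⟨ cong (f ^ N) fu≡fv ⟩
    (f ^ N) (f v)    ≡⟨ ^-shift N v ⟩
    (f ^ suc N) v    ≡⟨ ^-return-multiple (suc (toℕ k)) (suc (toℕ l)) v-ret ⟩
    v                ∎
    where
    open ≡-Reasoning
    N = toℕ l + toℕ k * suc (toℕ l)
    u-ret′ : (f ^ suc N) u ≡ u
    u-ret′ = subst (λ t → (f ^ t) u ≡ u) (*-comm (suc (toℕ l)) (suc (toℕ k)))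
               (^-return-multiple (suc (toℕ l)) (suc (toℕ k)) u-ret)

  periodic-exists : Fin n → Σ (Fin n) IsPeriodic
  periodic-exists v
    with i , j , i<j , fⁱv≡fʲv ← pigeonhole (≤-reflexive refl) (λ (t : Fin (suc n)) → (f ^ toℕ t) v)
    with o , i+o≡j ← m≤n⇒∃[o]m+o≡n i<j
    = (f ^ toℕ i) v , fromℕ< o<n , returns
    where
    o<n : o < n
    o<n = ≤-trans (s≤s (m≤n+m o (toℕ i))) (≤-trans (≤-reflexive i+o≡j) (s≤s⁻¹ (toℕ<n j)))
    returns : (f ^ suc (toℕ (fromℕ< o<n))) ((f ^ toℕ i) v) ≡ (f ^ toℕ i) v
    returns rewrite toℕ-fromℕ< o<n = begin
      (f ^ suc o) ((f ^ toℕ i) v) ≡⟨ cong-app (^-homo f (suc o) (toℕ i)) v ⟨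
      (f ^ (suc o + toℕ i)) v     ≡⟨ cong (λ t → (f ^ t) v) (trans (cong suc (+-comm o (toℕ i))) i+o≡j) ⟩
      (f ^ toℕ j) v               ≡⟨ fⁱv≡fʲv ⟨
      (f ^ toℕ i) v               ∎
      where open ≡-Reasoning

Proper : {C : Set} {n : ℕ} → Graph n → (Fin n → C) → Set
Proper {n = n} G φ = (u v : Fin n) → G u v → φ u ≢ φ v

IsOnlyLColoring : {n : ℕ} → Graph n → ListAssignment n → (Fin n → ℕ) → Set
IsOnlyLColoring {n} G L c = (c′ : Fin n → ℕ) → IsLColoring G L c′ → (v : Fin n) → c′ v ≡ c v

module _ {n : ℕ} {G : Graph n} {L : ListAssignment n} {c : Fin n → ℕ}
         (c-col : IsLColoring G L c) where

  private
    loopless : ∀ {v} → ¬ G v v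
    loopless {v} g = proj₁ c-col v v g refl

  only⇒alternative-used : IsOnlyLColoring G L c → ∀ {v x} → x ∈ L v → x ≢ c v → ∃ λ w → c w ≡ x
  only⇒alternative-used c-only {v} {x} x∈Lv x≢cv with any? (λ w → c w ≟ℕ x)
  ... | yes used = used
  ... | no unused =
    contradiction (trans (sym recolored-v) (c-only recolored (recolored-proper , recolored-allowed) v)) x≢cv
    where
    recolored : Fin n → ℕ
    recolored u with u ≟ v
    ... | yes _ = x
    ... | no _  = c u

    recolored-v : recolored v ≡ x
    recolored-v with v ≟ v
    ... | yes _  = refl
    ... | no v≢v = contradiction refl v≢v

    recolored-proper : Proper G recolored
    recolored-proper u w g with u ≟ v | w ≟ v
    ... | yes refl | yes refl = contradiction g loopless
    ... | yes refl | no _     = λ x≡cw → unused (w , sym x≡cw)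
    ... | no _     | yes refl = λ cu≡x → unused (u , cu≡x)
    ... | no _     | no _     = proj₁ c-col u w g

    recolored-allowed : ∀ u → recolored u ∈ L u
    recolored-allowed u with u ≟ v
    ... | yes refl = x∈Lv
    ... | no _     = proj₂ c-col u

  module ShiftAlongCycles (f : Fin n → Fin n) (f-allowed : ∀ v → c (f v) ∈ L v)
         (f-sole : ∀ v w → c w ≡ c (f v) → w ≡ f v) where
    open PeriodicPoints f

    shifted : Fin n → ℕ
    shifted u with isPeriodic? u
    ... | yes _ = c (f u)
    ... | no _  = c u

    shifted-periodic : ∀ {u} → IsPeriodic u → shifted u ≡ c (f u)
    shifted-periodic {u} u-per with isPeriodic? u
    ... | yes _     = refl
    ... | no ¬u-per = contradiction u-per ¬u-per

    shifted-proper : Proper G shifted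
    shifted-proper u v g with isPeriodic? u | isPeriodic? v
    ... | yes u-per | yes v-per = λ e →
      contradiction (subst (λ w → G w v) (periodic-injective u-per v-per (f-sole v (f u) e)) g) loopless
    ... | yes u-per | no ¬v-per = λ e → ¬v-per (subst IsPeriodic (sym (f-sole u v (sym e))) (periodic-step u-per))
    ... | no ¬u-per | yes v-per = λ e → ¬u-per (subst IsPeriodic (sym (f-sole v u e)) (periodic-step v-per))
    ... | no _      | no _      = proj₁ c-col u v g

    shifted-allowed : ∀ u → shifted u ∈ L u
    shifted-allowed u with isPeriodic? u
    ... | yes _ = f-allowed u
    ... | no _  = proj₂ c-col u

    only⇒¬moving : IsOnlyLColoring G L c → (∀ v → c (f v) ≢ c v) → Fin n → ⊥
    only⇒¬moving c-only f-moves v with u , u-per ← periodic-exists v =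
      f-moves u (trans (sym (shifted-periodic u-per)) (c-only shifted (shifted-proper , shifted-allowed) u))

module _ {n r : ℕ} (a b : Fin r → Fin n) where

  IsMatched : Fin n → Fin n → Set
  IsMatched u v = ∃ λ i → (u ≡ a i × v ≡ b i) ⊎ (u ≡ b i × v ≡ a i)

  isMatched? : ∀ u v → Dec (IsMatched u v)
  isMatched? u v = any? λ i → ((u ≟ a i) ×-dec (v ≟ b i)) ⊎-dec ((u ≟ b i) ×-dec (v ≟ a i))

  KnMinus-collision : {C : Set} {φ : Fin n → C} → Proper (KnMinus a b) φ →
    ∀ {u v} → φ u ≡ φ v → u ≡ v ⊎ IsMatched u v
  KnMinus-collision proper {u} {v} φu≡φv with u ≟ v | isMatched? u v
  ... | yes u≡v | _         = inj₁ u≡v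
  ... | no _    | yes match = inj₂ match
  ... | no u≢v  | no ¬match = contradiction φu≡φv (proper u v (u≢v , ¬match))

  KnMinus-sole-color : {C : Set} {φ : Fin n → C} → Proper (KnMinus a b) φ →
    ∀ {v} → (∀ i → φ (a i) ≢ φ v) → ∀ {w} → φ w ≡ φ v → w ≡ v
  KnMinus-sole-color proper φa≢φv φw≡φv with KnMinus-collision proper φw≡φv
  ... | inj₁ w≡v                   = w≡v
  ... | inj₂ (i , inj₁ (refl , _)) = contradiction φw≡φv (φa≢φv i)
  ... | inj₂ (i , inj₂ (_ , refl)) = contradiction refl (φa≢φv i)

  avoiding-color : {L : ListAssignment n} → IsKAssignment (r + 2) L → (c : Fin n → ℕ) →
    ∀ v → ∃ λ x → x ∈ L v × x ≢ c v × (∀ i → c (a i) ≢ x)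
  avoiding-color {L} L-size c v
    with x , x∈L , x∉ ← length<⇒∃∉ _≟ℕ_ (proj₁ (L-size v)) (≤-reflexive
           (trans (cong (2 +_) (length-tabulate (c ∘ a))) (trans (+-comm 2 r) (sym (proj₂ (L-size v))))))
    = x , x∈L , x∉ ∘ here , λ i ca≡x → x∉ (there (subst (_∈ _) ca≡x (∈-tabulate⁺ i)))

  KnMinus-hasM : Fin n → HasM (KnMinus a b) (r + 2)
  KnMinus-hasM v₀ (L , L-size , c , c-col , c-only) =
    ShiftAlongCycles.only⇒¬moving c-col f f-allowed f-sole c-only f-moves v₀
    where
    next : ∀ v → ∃ λ w → c w ∈ L v × c w ≢ c v × (∀ i → c (a i) ≢ c w)
    next v with x , x∈L , x≢cv , ca≢x ← avoiding-color L-size c v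
           with w , refl ← only⇒alternative-used c-col c-only x∈L x≢cv
      = w , x∈L , x≢cv , ca≢x

    f : Fin n → Fin n
    f = proj₁ ∘ next

    f-allowed : ∀ v → c (f v) ∈ L v
    f-allowed = proj₁ ∘ proj₂ ∘ next

    f-moves : ∀ v → c (f v) ≢ c v
    f-moves = proj₁ ∘ proj₂ ∘ proj₂ ∘ next

    f-sole : ∀ v w → c w ≡ c (f v) → w ≡ f v
    f-sole v w = KnMinus-sole-color (proj₁ c-col) (proj₂ (proj₂ (proj₂ (next v))))

  -- If a i and b i had different colors, the map fixing every b j ≠ b i and sending every other
  -- vertex to its color would inject Fin n into Fin n ∖ {b i}.
  KnMinus-matched-monochromatic : (∀ i j → b i ≡ b j → i ≡ j) → {φ : Fin n → Fin n} →
    Proper (KnMinus a b) φ → (∀ v j → φ v ≢ b j) → ∀ i → φ (a i) ≡ φ (b i)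
  KnMinus-matched-monochromatic b-inj {φ} proper φ≢b i =
    decidable-stable (φ (a i) ≟ φ (b i)) λ split →
      let x , ψx≡bi = injective⇒surjective (ψ-injective split) (b i) in ψ-misses x ψx≡bi
    where
    Kept : Fin n → Set
    Kept v = (∃ λ j → b j ≡ v) × v ≢ b i

    kept? : ∀ v → Dec (Kept v)
    kept? v = any? (λ j → b j ≟ v) ×-dec ¬? (v ≟ b i)

    unkept-b : ∀ {j} → ¬ Kept (b j) → j ≡ i
    unkept-b {j} ¬kept = b-inj j i (decidable-stable (b j ≟ b i) λ bj≢bi → ¬kept ((j , refl) , bj≢bi))

    ψ : Fin n → Fin n
    ψ v with kept? v
    ... | yes _ = v
    ... | no _  = φ v

    ψ-misses : ∀ x → ψ x ≢ b i
    ψ-misses x with kept? x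
    ... | yes (_ , x≢bi) = x≢bi
    ... | no _           = φ≢b x i

    unkept-injective : φ (a i) ≢ φ (b i) → ∀ {u v} → ¬ Kept u → ¬ Kept v → φ u ≡ φ v → u ≡ v
    unkept-injective split ¬ku ¬kv φu≡φv with KnMinus-collision proper φu≡φv
    ... | inj₁ u≡v = u≡v
    ... | inj₂ (j , inj₁ (refl , refl)) with refl ← unkept-b ¬kv = contradiction φu≡φv split
    ... | inj₂ (j , inj₂ (refl , refl)) with refl ← unkept-b ¬ku = contradiction (sym φu≡φv) split

    ψ-injective : φ (a i) ≢ φ (b i) → Injective _≡_ _≡_ ψ
    ψ-injective split {u} {v} with kept? u | kept? v
    ... | yes _                | yes _ = id
    ... | yes ((j , refl) , _) | no _  = λ bj≡φv → contradiction (sym bj≡φv) (φ≢b v j)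
    ... | no _ | yes ((j , refl) , _)  = λ φu≡bj → contradiction φu≡bj (φ≢b u j)
    ... | no ¬ku | no ¬kv              = unkept-injective split ¬ku ¬kv

module ForcedColoring {n r : ℕ} {a b : Fin r → Fin n} (matching : IsMatching a b)
       (n-large : 3 * r + 1 ≤ n) (m : ℕ) (m≤r : m ≤ r) where

  private
    a-inj = proj₁ matching
    b-inj = proj₁ (proj₂ matching)
    a≢b   = proj₂ (proj₂ matching)

  IsA IsB : Fin n → Set
  IsA v = ∃ λ i → a i ≡ v
  IsB v = ∃ λ i → b i ≡ v

  isA? : ∀ v → Dec (IsA v)
  isA? v = any? λ i → a i ≟ v

  isB? : ∀ v → Dec (IsB v)
  isB? v = any? λ i → b i ≟ v

  a∉B : ∀ i → ¬ IsB (a i)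
  a∉B i (j , bj≡ai) = a≢b i j (sym bj≡ai)

  Spare : Fin r → Fin n → Set
  Spare i v = ¬ IsB v × v ≢ a i

  spare : Fin r → List (Fin n)
  spare i = filter (λ v → ¬? (isB? v) ×-dec ¬? (v ≟ a i)) (allFin n)

  spare-unique : ∀ i → Unique (spare i)
  spare-unique i = Unique.filter⁺ _ (Unique.allFin⁺ n)

  spare-spare : ∀ i → All (Spare i) (spare i)
  spare-spare i = all-filter _ (allFin n)

  spare-long : ∀ i → m + m ≤ length (spare i)
  spare-long i = ≤-trans (+-mono-≤ m≤r m≤r) (+-cancelʳ-≤ r (r + r) (length (spare i)) (s≤s⁻¹ 3r+1≤))
    where
    covers : allFin n ⊆ (a i ∷ spare i) ++ tabulate b
    covers {v} _ with isB? v | v ≟ a i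
    ... | yes (j , refl) | _        = ∈-++⁺ʳ (a i ∷ spare i) (∈-tabulate⁺ j)
    ... | no _           | yes refl = here refl
    ... | no ¬b          | no v≢ai  = there (∈-++⁺ˡ (∈-filter⁺ _ (∈-allFin v) (¬b , v≢ai)))
    3r+1≡ : 3 * r + 1 ≡ suc (r + r + r)
    3r+1≡ = begin
      3 * r + 1               ≡⟨ +-comm (3 * r) 1 ⟩
      suc (r + (r + (r + 0))) ≡⟨ cong (λ k → suc (r + (r + k))) (+-identityʳ r) ⟩
      suc (r + (r + r))       ≡⟨ cong suc (+-assoc r r r) ⟨
      suc (r + r + r)         ∎
      where open ≡-Reasoning

    3r+1≤ : suc (r + r + r) ≤ suc (length (spare i) + r)
    3r+1≤ = begin
      suc (r + r + r)                              ≡⟨ 3r+1≡ ⟨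
      3 * r + 1                                    ≤⟨ n-large ⟩
      n                                            ≡⟨ length-tabulate id ⟨
      length (allFin n)                            ≤⟨ Unique∧⊆⇒length≤ (Unique.allFin⁺ n) covers ⟩
      length ((a i ∷ spare i) ++ tabulate b)       ≡⟨ cong suc (length-++ (spare i)) ⟩
      suc (length (spare i) + length (tabulate b)) ≡⟨ cong (suc ∘ (length (spare i) +_)) (length-tabulate b) ⟩
      suc (length (spare i) + r)                   ∎
      where open ≤-Reasoning

  listA listB : Fin r → List (Fin n)
  listA i = a i ∷ take m (spare i)
  listB i = a i ∷ take m (drop m (spare i))

  listOther : Fin n → List (Fin n)
  listOther v = v ∷ map a (take m (allFin r))

  lists : Fin n → List (Fin n)
  lists v with isB? v | isA? v
  ... | yes (i , _) | _           = listB i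
  ... | no _        | yes (i , _) = listA i
  ... | no _        | no _        = listOther v

  canonical : Fin n → Fin n
  canonical v with isB? v
  ... | yes (i , _) = a i
  ... | no _        = v

  lists-a : ∀ i → lists (a i) ≡ listA i
  lists-a i with isB? (a i) | isA? (a i)
  ... | yes ai∈B | _               = contradiction ai∈B (a∉B i)
  ... | no _     | yes (j , aj≡ai) = cong listA (a-inj j i aj≡ai)
  ... | no _     | no ai∉A         = contradiction (i , refl) ai∉A

  lists-b : ∀ i → lists (b i) ≡ listB i
  lists-b i with isB? (b i)
  ... | yes (j , bj≡bi) = cong listB (b-inj j i bj≡bi)
  ... | no bi∉B         = contradiction (i , refl) bi∉B

  lists-other : ∀ {v} → ¬ IsA v → ¬ IsB v → lists v ≡ listOther v
  lists-other {v} v∉A v∉B with isB? v | isA? v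
  ... | yes v∈B | _       = contradiction v∈B v∉B
  ... | no _    | yes v∈A = contradiction v∈A v∉A
  ... | no _    | no _    = refl

  ai∉spare : ∀ i → All (a i ≢_) (spare i)
  ai∉spare i = All.map (λ (_ , z≢ai) ai≡z → z≢ai (sym ai≡z)) (spare-spare i)

  prefix⊆A : ∀ {z} → z ∈ map a (take m (allFin r)) → IsA z
  prefix⊆A z∈prefix = let j , _ , z≡aj = ∈-map⁻ a z∈prefix in j , sym z≡aj

  length-take-spare : ∀ i → length (take m (spare i)) ≡ m
  length-take-spare i = length-take-≤ m (spare i) (m+n≤o⇒m≤o m (spare-long i))

  length-take-drop-spare : ∀ i → length (take m (drop m (spare i))) ≡ m
  length-take-drop-spare i = length-take-≤ m (drop m (spare i))
    (subst (m ≤_) (sym (length-drop m (spare i))) (m+n≤o⇒m≤o∸n m (spare-long i)))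

  length-prefix : length (map a (take m (allFin r))) ≡ m
  length-prefix = trans (length-map a (take m (allFin r)))
    (length-take-≤ m (allFin r) (subst (m ≤_) (sym (length-tabulate id)) m≤r))

  lists-length : ∀ v → length (lists v) ≡ suc m
  lists-length v with isB? v | isA? v
  ... | yes (i , _) | _           = cong suc (length-take-drop-spare i)
  ... | no _        | yes (i , _) = cong suc (length-take-spare i)
  ... | no _        | no _        = cong suc length-prefix

  lists-unique : ∀ v → Unique (lists v)
  lists-unique v with isB? v | isA? v
  ... | yes (i , _) | _           =
    take⁺ m (drop⁺ m (ai∉spare i)) ∷ Unique.take⁺ m (Unique.drop⁺ m (spare-unique i))
  ... | no _        | yes (i , _) = take⁺ m (ai∉spare i) ∷ Unique.take⁺ m (spare-unique i)
  ... | no _        | no v∉A      =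
    All.tabulate (λ z∈prefix v≡z → v∉A (subst IsA (sym v≡z) (prefix⊆A z∈prefix)))
      ∷ Unique.map⁺ (a-inj _ _) (Unique.take⁺ m (Unique.allFin⁺ r))

  lists-avoid-B : ∀ v → All (¬_ ∘ IsB) (lists v)
  lists-avoid-B v with isB? v | isA? v
  ... | yes (i , _) | _           = a∉B i ∷ take⁺ m (drop⁺ m (All.map proj₁ (spare-spare i)))
  ... | no _        | yes (i , _) = a∉B i ∷ take⁺ m (All.map proj₁ (spare-spare i))
  ... | no v∉B      | no _        =
    v∉B ∷ All.tabulate λ z∈prefix → let j , aj≡z = prefix⊆A z∈prefix in subst (¬_ ∘ IsB) aj≡z (a∉B j)

  canonical∈lists : ∀ v → canonical v ∈ lists v
  canonical∈lists v with isB? v | isA? v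
  ... | yes _ | _              = here refl
  ... | no _  | yes (_ , refl) = here refl
  ... | no _  | no _           = here refl

  canonical-proper : Proper (KnMinus a b) canonical
  canonical-proper u v (u≢v , ¬matched) with isB? u | isB? v
  ... | yes (i , refl) | yes (j , refl) = λ ai≡aj → u≢v (cong b (a-inj i j ai≡aj))
  ... | yes (i , refl) | no _           = λ ai≡v → ¬matched (i , inj₂ (refl , sym ai≡v))
  ... | no _           | yes (j , refl) = λ u≡aj → ¬matched (j , inj₁ (u≡aj , refl))
  ... | no _           | no _           = u≢v

  listA∩listB : ∀ i {z} → z ∈ listA i → z ∈ listB i → z ≡ a i
  listA∩listB i (here z≡ai) _           = z≡ai
  listA∩listB i (there _)   (here z≡ai) = z≡ai
  listA∩listB i (there z∈A) (there z∈B) =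
    contradiction z∈B (Unique⇒take-drop-disjoint m m (spare-unique i) z∈A)

  other-adjacent-a : ∀ {v} → ¬ IsA v → ¬ IsB v → ∀ j → KnMinus a b (a j) v
  other-adjacent-a v∉A v∉B j = (λ aj≡v → v∉A (j , aj≡v)) , λ
    { (k , inj₁ (_ , v≡bk)) → v∉B (k , sym v≡bk)
    ; (k , inj₂ (_ , v≡ak)) → v∉A (k , sym v≡ak)
    }

  L : ListAssignment n
  L = map toℕ ∘ lists

  L-size : IsKAssignment (suc m) L
  L-size v =
    Unique.map⁺ toℕ-injective (lists-unique v) , trans (length-map toℕ (lists v)) (lists-length v)

  canonical-isLColoring : IsLColoring (KnMinus a b) L (toℕ ∘ canonical)
  canonical-isLColoring =
    (λ u v g → canonical-proper u v g ∘ toℕ-injective) , λ v → ∈-map⁺ toℕ (canonical∈lists v)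

  proper-choice≡canonical : {φ : Fin n → Fin n} → Proper (KnMinus a b) φ → (∀ v → φ v ∈ lists v) →
    ∀ v → φ v ≡ canonical v
  proper-choice≡canonical {φ} φ-proper φ∈lists = φ≡canonical
    where
    φ-monochromatic : ∀ i → φ (a i) ≡ φ (b i)
    φ-monochromatic = KnMinus-matched-monochromatic a b b-inj φ-proper
      λ v j φv≡bj → All.lookup (lists-avoid-B v) (φ∈lists v) (j , sym φv≡bj)

    φ-a : ∀ i → φ (a i) ≡ a i
    φ-a i = listA∩listB i (subst (φ (a i) ∈_) (lists-a i) (φ∈lists (a i)))
      (subst₂ _∈_ (sym (φ-monochromatic i)) (lists-b i) (φ∈lists (b i)))

    φ≡canonical : ∀ v → φ v ≡ canonical v
    φ≡canonical v with isB? v | isA? v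
    ... | yes (i , refl) | _              = trans (sym (φ-monochromatic i)) (φ-a i)
    ... | no _           | yes (i , refl) = φ-a i
    ... | no v∉B         | no v∉A with subst (φ v ∈_) (lists-other v∉A v∉B) (φ∈lists v)
    ...   | here φv≡v         = φv≡v
    ...   | there φv∈prefix with j , aj≡φv ← prefix⊆A φv∈prefix =
      contradiction (trans (φ-a j) aj≡φv) (φ-proper (a j) v (other-adjacent-a v∉A v∉B j))

  canonical-only : IsOnlyLColoring (KnMinus a b) L (toℕ ∘ canonical)
  canonical-only c (c-proper , c-allowed) v =
    trans (c≡φ v) (cong toℕ (proper-choice≡canonical φ-proper φ∈lists v))
    where
    pick : ∀ v → ∃ λ w → w ∈ lists v × c v ≡ toℕ w
    pick v = ∈-map⁻ toℕ (c-allowed v)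

    φ : Fin n → Fin n
    φ = proj₁ ∘ pick

    φ∈lists : ∀ v → φ v ∈ lists v
    φ∈lists = proj₁ ∘ proj₂ ∘ pick

    c≡φ : ∀ v → c v ≡ toℕ (φ v)
    c≡φ = proj₂ ∘ proj₂ ∘ pick

    φ-proper : Proper (KnMinus a b) φ
    φ-proper u v g φu≡φv = c-proper u v g (trans (c≡φ u) (trans (cong toℕ φu≡φv) (sym (c≡φ v))))

  uniquelyColorable : UniquelyKListColorable (KnMinus a b) (suc m)
  uniquelyColorable = L , L-size , toℕ ∘ canonical , canonical-isLColoring , canonical-only

proposition2p5 : (r n : ℕ) → 3 * r + 1 ≤ n →
    (a b : Fin r → Fin n) → IsMatching a b →
    IsMNumber (KnMinus a b) (r + 2)
proposition2p5 r n n-large a b matching = ≤-trans (s≤s z≤n) (m≤n+m 2 r) , KnMinus-hasM a b v₀ , below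
  where
  v₀ : Fin n
  v₀ = fromℕ< (≤-trans (m≤n+m 1 (3 * r)) n-large)

  below : (k : ℕ) → 1 ≤ k → k < r + 2 → ¬ HasM (KnMinus a b) k
  below (suc m) _ k<r+2 k-hasM = k-hasM (ForcedColoring.uniquelyColorable matching n-large m m≤r)
    where
    m≤r : m ≤ r
    m≤r = +-cancelʳ-≤ 2 m r (subst (_≤ r + 2) (+-comm 2 m) k<r+2)
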